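{- Let $G$ be a connected $\{K_{1,3},B_{1,1}\}$-free graph. Then $G$ is not $P_{5}$-free if and only if $G\in\mathcal{P}(5)$.
   Context: All graphs are finite and simple. A graph is $\mathcal{F}$-free if it contains no member of $\mathcal{F}$ as an induced subgraph. $K_{1,3}$ is the star with three leaves, $P_n$ is the path on $n$ vertices. $B_{1,1}$ is obtained from a triangle $abc$ by adding a vertex adjacent only to $a$ and another vertex adjacent only to $b$. For an integer $l\geq 5$ and pairwise vertex-disjoint nonempty cliques $L_1,\dots,L_l$, the fat $l$-path $F_p(L_1,\dots,L_l)$ is the graph on $L_1\cup\dots\cup L_l$ in which each $L_i$ is a clique, every vertex of $L_i$ is adjacent to every vertex of $L_{i+1}$ for $1\leq i\leq l-1$, and there are no other edges. For pairwise vertex-disjoint nonempty cliques $L_0,\dots,L_l$, the fat $l$-cycle $F_c(L_0,\dots,L_l)$ is the graph on $L_0\cup\dots\cup L_l$ in which each $L_i$ is a clique, every vertex of $L_i$ is adjacent to every vertex of $L_{i+1}$ for $0\leq i\leq l$ (indices modulo $l+1$), and there are no other edges. For $l\geq 5$, $\mathcal{P}(l)$ denotes the family of all fat $i$-paths and fat $i$-cycles for all $i\geq l$ (membership up to isomorphism). -}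

module Defs where

open import Data.Nat using (ℕ; zero; suc; _≤_; _%_; _≡ᵇ_)
open import Data.Fin using (Fin; toℕ; _≟_)
open import Data.Bool using (Bool; true; false; not; _∧_; _∨_)
open import Data.Bool.Properties using (∧-comm; ∨-comm)
open import Data.List using (List; []; _∷_)
open import Data.Bool.ListAction using (any)
open import Data.Product using (Σ; ∃; _×_; _,_)
open import Data.Sum using (_⊎_)
open import Relation.Nullary using (¬_; yes; no)
open import Relation.Nullary.Decidable using (⌊_⌋)
open import Relation.Binary.PropositionalEquality using (_≡_; _≢_; refl; sym; cong; cong₂)
open import Function.Definitions using (Injective)

record Graph (n : ℕ) : Set where
  field
    adj    : Fin n → Fin n → Bool
    adjSym : ∀ u v → adj u v ≡ adj v u
    adjIrr : ∀ v → adj v v ≡ false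
open Graph public

private
  neq : ∀ {n} → Fin n → Fin n → Bool
  neq u v = not ⌊ u ≟ v ⌋

  neq-sym : ∀ {n} (u v : Fin n) → neq u v ≡ neq v u
  neq-sym u v with u ≟ v | v ≟ u
  ... | yes _ | yes _ = refl
  ... | no _  | no _  = refl
  ... | yes p | no q  with q (sym p)
  ... | ()
  neq-sym u v | no q | yes p with q (sym p)
  ... | ()

  neq-refl : ∀ {n} (v : Fin n) → neq v v ≡ false
  neq-refl v with v ≟ v
  ... | yes _ = refl
  ... | no q with q refl
  ... | ()

mkGraph : ∀ {n} → (Fin n → Fin n → Bool) → Graph n
mkGraph e = record
  { adj    = λ u v → neq u v ∧ (e u v ∨ e v u)
  ; adjSym = λ u v → cong₂ _∧_ (neq-sym u v) (∨-comm (e u v) (e v u))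
  ; adjIrr = λ v → helper v
  }
  where
  helper : ∀ v → neq v v ∧ (e v v ∨ e v v) ≡ false
  helper v with neq v v | neq-refl v
  ... | .false | refl = refl

data Edge : Set where
  _—_ : ℕ → ℕ → Edge

fromEdges : (n : ℕ) → List Edge → Graph n
fromEdges n es = mkGraph (λ u v → any (λ { (a — b) → (toℕ u ≡ᵇ a) ∧ (toℕ v ≡ᵇ b) }) es)

K13 : Graph 4
K13 = fromEdges 4 ((0 — 1) ∷ (0 — 2) ∷ (0 — 3) ∷ [])

P5 : Graph 5
P5 = fromEdges 5 ((0 — 1) ∷ (1 — 2) ∷ (2 — 3) ∷ (3 — 4) ∷ [])

-- B_{1,1}: triangle a=0, b=1, c=2; vertex 3 adjacent only to a, vertex 4 only to b.
B11 : Graph 5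
B11 = fromEdges 5 ((0 — 1) ∷ (1 — 2) ∷ (0 — 2) ∷ (0 — 3) ∷ (1 — 4) ∷ [])

InducedSub : ∀ {m n} → Graph m → Graph n → Set
InducedSub {m} {n} H G =
  Σ (Fin m → Fin n) λ f → Injective _≡_ _≡_ f × (∀ i j → adj H i j ≡ adj G (f i) (f j))

Free : ∀ {m n} → Graph m → Graph n → Set
Free H G = ¬ InducedSub H G

data Reach {n} (G : Graph n) : Fin n → Fin n → Set where
  here : ∀ {u} → Reach G u u
  step : ∀ {u v w} → adj G u v ≡ true → Reach G v w → Reach G u w

Connected : ∀ {n} → Graph n → Set
Connected {n} G = ∀ (u v : Fin n) → Reach G u v

PathJoin : ∀ {l} → Fin l → Fin l → Set
PathJoin i j = i ≡ j ⊎ suc (toℕ i) ≡ toℕ j ⊎ suc (toℕ j) ≡ toℕ i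

CycleJoin : ∀ {l} → Fin (suc l) → Fin (suc l) → Set
CycleJoin {l} i j =
  i ≡ j ⊎ toℕ j ≡ suc (toℕ i) % suc l ⊎ toℕ i ≡ suc (toℕ j) % suc l

-- G is (isomorphic to) a fat l-path F_p(L_1,...,L_l): the vertex set is
-- partitioned into l nonempty parts (L_i = part⁻¹ i), and two distinct
-- vertices are adjacent iff their parts are equal or consecutive.
FatPath : ∀ {n} → ℕ → Graph n → Set
FatPath {n} l G =
  Σ (Fin n → Fin l) λ part →
    (∀ i → ∃ λ v → part v ≡ i) ×
    (∀ u v → (adj G u v ≡ true → u ≢ v × PathJoin (part u) (part v))
           × (u ≢ v × PathJoin (part u) (part v) → adj G u v ≡ true))

-- G is (isomorphic to) a fat l-cycle F_c(L_0,...,L_l) (l+1 nonempty cliques).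
FatCycle : ∀ {n} → ℕ → Graph n → Set
FatCycle {n} l G =
  Σ (Fin n → Fin (suc l)) λ part →
    (∀ i → ∃ λ v → part v ≡ i) ×
    (∀ u v → (adj G u v ≡ true → u ≢ v × CycleJoin (part u) (part v))
           × (u ≢ v × CycleJoin (part u) (part v) → adj G u v ≡ true))

InFamilyP : ∀ {n} → ℕ → Graph n → Set
InFamilyP l0 G =
  (∃ λ l → l0 ≤ l × FatPath l G) ⊎ (∃ λ l → l0 ≤ l × FatCycle l G)

module Submission where

-- A P₅ is a fat 5-path, so it suffices to grow an induced fat path as long as possible.  Let V
-- induce a fat path with at least five cliques and let x ∉ V have a neighbour in V.  Each of the
-- finitely many ways in which x could see the cliques irregularly produces an induced claw or
-- B₁,₁; what remains is that x sees exactly the cliques c - 1, c, c + 1 for some c, so that x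
-- joins clique c or starts a new end clique, or that x sees exactly the two end cliques.  When no
-- vertex can be added any more, either V is everything, or, by connectivity and claw-freeness,
-- every other vertex sees exactly the two end cliques and these vertices form one more clique,
-- closing the path into a fat cycle.  Conversely, the first five cliques of a fat path or fat
-- cycle with at least five of them contain an induced P₅.

open import Defs
open import Data.Bool using (Bool; true; false)
import Data.Bool.Properties as Bool
open import Data.Empty using (⊥; ⊥-elim)
open import Data.Fin as Fin using (Fin; toℕ; fromℕ<)
open import Data.Fin.Patterns
open import Data.Fin.Properties using (any?; all?; toℕ-injective; toℕ-fromℕ<; toℕ<n)
import Data.Fin.Properties as Finₚ
open import Data.Fin.Subset using (Subset; _∈_; _∉_; _∪_; ⁅_⁆; _⊂_; _⊃_)
open import Data.Fin.Subset.Induction using (⊃-wellFounded; Acc; acc)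
open import Data.Fin.Subset.Properties
  using (_∈?_; x∈p∪q⁺; x∈p∪q⁻; x∈⁅x⁆; x∈⁅y⁆⇒x≡y; p⊆p∪q)
open import Data.Nat using (ℕ; zero; suc; _+_; _∸_; _%_; _≤_; _<_; z≤n; s≤s; z<s; _≡ᵇ_)
open import Data.Nat.DivMod using (m<n⇒m%n≡m; n%n≡0)
open import Data.Nat.Properties
open import Data.Product using (Σ; ∃; _×_; _,_; proj₁; proj₂)
open import Data.Sum using (_⊎_; inj₁; inj₂; map₁)
import Data.Sum as Sum
open import Data.Vec using (tabulate)
import Data.Vec.Functional as Vector
open import Data.Vec.Properties using (lookup∘tabulate; []=⇒lookup; lookup⇒[]=)
open import Data.Vec.Functional.Properties using (updateAt-updates; updateAt-minimal)
open import Function.Base using (_∘_; id; const)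
open import Function.Bundles using (_⇔_; mk⇔; Equivalence)
open import Function.Construct.Composition using (_⇔-∘_)
open import Function.Construct.Symmetry using (⇔-sym)
open import Relation.Binary using (tri<; tri≈; tri>)
open import Relation.Binary.PropositionalEquality
open import Relation.Nullary using (¬_; Dec; yes; no; does; contradiction)
open import Relation.Nullary.Decidable
  using (map′; ¬?; _×-dec_; _→-dec_; _⊎-dec_; toWitness; decidable-stable; dec-true)
open import Relation.Unary using (Decidable)

-- Arithmetic of clique indices

near : ℕ → ℕ → Bool
near zero    zero    = true
near zero    (suc b) = b ≡ᵇ 0
near (suc a) zero    = a ≡ᵇ 0
near (suc a) (suc b) = near a b

near-refl : ∀ a → near a a ≡ true
near-refl zero    = refl
near-refl (suc a) = near-refl a

near-suc : ∀ a → near a (suc a) ≡ true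
near-suc zero    = refl
near-suc (suc a) = near-suc a

near-suc˘ : ∀ a → near (suc a) a ≡ true
near-suc˘ zero    = refl
near-suc˘ (suc a) = near-suc˘ a

near-sym : ∀ a b → near a b ≡ near b a
near-sym zero    zero    = refl
near-sym zero    (suc b) = refl
near-sym (suc a) zero    = refl
near-sym (suc a) (suc b) = near-sym a b

near-far : ∀ {a b} → 2 + a ≤ b → near a b ≡ false
near-far {zero}  {suc (suc b)} _           = refl
near-far {zero}  {suc zero}    (s≤s ())
near-far {suc a} {suc b}       (s≤s 2+a≤b) = near-far 2+a≤b

near-far˘ : ∀ {a b} → 2 + b ≤ a → near a b ≡ false
near-far˘ {a} {b} 2+b≤a = trans (near-sym a b) (near-far 2+b≤a)

near⇔ : ∀ {a b} → near a b ≡ true ⇔ (a ≡ b ⊎ suc a ≡ b ⊎ suc b ≡ a)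
near⇔ {a} {b} = mk⇔ (to a b) from
  where
  to : ∀ a b → near a b ≡ true → a ≡ b ⊎ suc a ≡ b ⊎ suc b ≡ a
  to zero       zero       _ = inj₁ refl
  to zero       (suc zero) _ = inj₂ (inj₁ refl)
  to (suc zero) zero       _ = inj₂ (inj₂ refl)
  to (suc a)    (suc b)    h = Sum.map (cong suc) (Sum.map (cong suc) (cong suc)) (to a b h)
  from : ∀ {a b} → a ≡ b ⊎ suc a ≡ b ⊎ suc b ≡ a → near a b ≡ true
  from {a}     (inj₁ refl)        = near-refl a
  from {a}     (inj₂ (inj₁ refl)) = near-suc a
  from {b = b} (inj₂ (inj₂ refl)) = near-suc˘ b

near-∸ : ∀ m {a b} → a ≤ m → b ≤ m → near (m ∸ a) (m ∸ b) ≡ near a b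
near-∸ m       {zero}  {zero}  _         _         = near-refl m
near-∸ (suc m) {zero}  {suc b} _         (s≤s b≤m) = near-top b≤m
  where
  near-top : ∀ {m b} → b ≤ m → near (suc m) (m ∸ b) ≡ (b ≡ᵇ 0)
  near-top {m} {zero}  _   = near-suc˘ m
  near-top {m} {suc b} b<m = near-far˘ (s≤s (s≤s (∸-monoʳ-< z<s b<m)))
near-∸ (suc m) {suc a} {zero}  (s≤s a≤m) _         =
  trans (near-sym (m ∸ a) (suc m)) (near-∸ (suc m) {zero} {suc a} z≤n (s≤s a≤m))
near-∸ (suc m) {suc a} {suc b} (s≤s a≤m) (s≤s b≤m) = near-∸ m a≤m b≤m

data Offset : ℕ → ℕ → Set where
  far-below  : ∀ {a b} → 2 + b ≤ a → Offset a b
  just-below : ∀ {b} → Offset (suc b) b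
  same       : ∀ {a} → Offset a a
  just-above : ∀ {a} → Offset a (suc a)
  far-above  : ∀ {a b} → 2 + a ≤ b → Offset a b

offset : ∀ a b → Offset a b
offset zero          zero          = same
offset zero          (suc zero)    = just-above
offset zero          (suc (suc b)) = far-above (s≤s (s≤s z≤n))
offset (suc zero)    zero          = just-below
offset (suc (suc a)) zero          = far-below (s≤s (s≤s z≤n))
offset (suc a)       (suc b)       with offset a b
... | far-below 2+b≤a = far-below (s≤s 2+b≤a)
... | just-below      = just-below
... | same            = same
... | just-above      = just-above
... | far-above 2+a≤b = far-above (s≤s 2+a≤b)

data Position (k : ℕ) : ℕ → Set where
  first       : Position k 0
  second      : Position k 1
  middle      : ∀ {p} → p ≤ k → Position k (2 + p)
  penultimate : Position k (3 + k)
  last        : Position k (4 + k)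

position : ∀ k {p} → p < 5 + k → Position k p
position k {zero}        _ = first
position k {suc zero}    _ = second
position k {suc (suc p)} (s≤s (s≤s (s≤s p≤2+k))) with m≤n⇒m<n∨m≡n p≤2+k
... | inj₂ refl = last
... | inj₁ (s≤s p≤1+k) with m≤n⇒m<n∨m≡n p≤1+k
...   | inj₂ refl      = penultimate
...   | inj₁ (s≤s p≤k) = middle p≤k

module _ {p} {P : ℕ → Set p} (P? : Decidable P) where

  Least : Set p
  Least = ∃ λ k → P k × (∀ {j} → j < k → ¬ P j)

  least : ∀ {m} → P m → Least
  least {m} Pm = go m (m , ≤-refl , Pm)
    where
    go : ∀ m → (∃ λ j → j ≤ m × P j) → Least
    go zero    (.zero , z≤n , Pj) = zero , Pj , λ ()
    go (suc m) (j , j≤1+m , Pj) with anyUpTo? P? (suc m)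
    ... | yes (i , s≤s i≤m , Pi) = go m (i , i≤m , Pi)
    ... | no none with m≤n⇒m<n∨m≡n j≤1+m
    ...   | inj₁ j<1+m = ⊥-elim (none (j , j<1+m , Pj))
    ...   | inj₂ refl  = suc m , Pj , λ i<1+m Pi → none (_ , i<1+m , Pi)

-- Induced subgraphs

module _ {n : ℕ} (G : Graph n) where

  adj-swap : ∀ {u v b} → adj G u v ≡ b → adj G v u ≡ b
  adj-swap {u} {v} = trans (adjSym G v u)

  adj⇒≢ : ∀ {u v} → adj G u v ≡ true → u ≢ v
  adj⇒≢ {u} uv refl with trans (sym uv) (adjIrr G u)
  ... | ()

  separated⇒≢ : ∀ {w u v} → adj G w u ≡ true → adj G w v ≡ false → u ≢ v
  separated⇒≢ wu wv refl with trans (sym wu) wv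
  ... | ()

  Reach-closed : ∀ {p} (P : Fin n → Set p) → (∀ {u v} → adj G u v ≡ true → P u → P v) →
                 ∀ {u v} → Reach G u v → P u → P v
  Reach-closed P closed here        Pu = Pu
  Reach-closed P closed (step uw r) Pu = Reach-closed P closed r (closed uw Pu)

  EmbedsPair : ∀ {m} → Graph m → (Fin m → Fin n) → Fin m → Fin m → Set
  EmbedsPair H f i j = f i ≢ f j × adj H i j ≡ adj G (f i) (f j)

  inducedSub-fromUpper : ∀ {m} (H : Graph m) (f : Fin m → Fin n) →
                         (∀ {i j} → i Fin.< j → EmbedsPair H f i j) → InducedSub H G
  inducedSub-fromUpper H f upper = f , injective , preserves
    where
    injective : ∀ {i j} → f i ≡ f j → i ≡ j
    injective {i} {j} fi≡fj with Finₚ.<-cmp i j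
    ... | tri< i<j _ _ = ⊥-elim (proj₁ (upper i<j) fi≡fj)
    ... | tri≈ _ i≡j _ = i≡j
    ... | tri> _ _ j<i = ⊥-elim (proj₁ (upper j<i) (sym fi≡fj))
    preserves : ∀ i j → adj H i j ≡ adj G (f i) (f j)
    preserves i j with Finₚ.<-cmp i j
    ... | tri< i<j _ _  = proj₂ (upper i<j)
    ... | tri≈ _ refl _ = trans (adjIrr H i) (sym (adjIrr G (f i)))
    ... | tri> _ _ j<i  = trans (adjSym H i j) (trans (proj₂ (upper j<i)) (adjSym G (f j) (f i)))

  claw : ∀ {c a b d} → adj G c a ≡ true → adj G c b ≡ true → adj G c d ≡ true →
         adj G a b ≡ false → adj G a d ≡ false → adj G b d ≡ false →
         a ≢ b → a ≢ d → b ≢ d → InducedSub K13 G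
  claw {c} {a} {b} {d} ca cb cd ab ad bd a≢b a≢d b≢d = inducedSub-fromUpper K13 f upper
    where
    f : Fin 4 → Fin n
    f = c Vector.∷ a Vector.∷ b Vector.∷ d Vector.∷ Vector.[]
    upper : ∀ {i j} → i Fin.< j → EmbedsPair K13 f i j
    upper {0F} {1F} _ = adj⇒≢ ca , sym ca
    upper {0F} {2F} _ = adj⇒≢ cb , sym cb
    upper {0F} {3F} _ = adj⇒≢ cd , sym cd
    upper {1F} {2F} _ = a≢b , sym ab
    upper {1F} {3F} _ = a≢d , sym ad
    upper {2F} {3F} _ = b≢d , sym bd
    upper {_}  {0F} ()
    upper {Fin.suc _}           {1F} (s≤s ())
    upper {Fin.suc (Fin.suc _)} {2F} (s≤s (s≤s ()))
    upper {3F}                  {3F} (s≤s (s≤s (s≤s ())))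

  bull : ∀ {a b c d e} →
         adj G a b ≡ true → adj G b c ≡ true → adj G a c ≡ true →
         adj G a d ≡ true → adj G b e ≡ true →
         adj G b d ≡ false → adj G c d ≡ false → adj G a e ≡ false → adj G c e ≡ false →
         adj G d e ≡ false → InducedSub B11 G
  bull {a} {b} {c} {d} {e} ab bc ac ad be bd cd ae ce de = inducedSub-fromUpper B11 f upper
    where
    f : Fin 5 → Fin n
    f = a Vector.∷ b Vector.∷ c Vector.∷ d Vector.∷ e Vector.∷ Vector.[]
    upper : ∀ {i j} → i Fin.< j → EmbedsPair B11 f i j
    upper {0F} {1F} _ = adj⇒≢ ab , sym ab
    upper {0F} {2F} _ = adj⇒≢ ac , sym ac
    upper {0F} {3F} _ = adj⇒≢ ad , sym ad
    upper {0F} {4F} _ = separated⇒≢ (adj-swap ad) de , sym ae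
    upper {1F} {2F} _ = adj⇒≢ bc , sym bc
    upper {1F} {3F} _ = separated⇒≢ (adj-swap be) (adj-swap de) , sym bd
    upper {1F} {4F} _ = adj⇒≢ be , sym be
    upper {2F} {3F} _ = separated⇒≢ bc bd , sym cd
    upper {2F} {4F} _ = separated⇒≢ ac ae , sym ce
    upper {3F} {4F} _ = separated⇒≢ ad ae , sym de
    upper {_}  {0F} ()
    upper {Fin.suc _}                     {1F} (s≤s ())
    upper {Fin.suc (Fin.suc _)}           {2F} (s≤s (s≤s ()))
    upper {Fin.suc (Fin.suc (Fin.suc _))} {3F} (s≤s (s≤s (s≤s ())))
    upper {4F}                            {4F} (s≤s (s≤s (s≤s (s≤s ()))))

∃-function? : ∀ {a} m {n} {P : (Fin m → Fin n) → Set a} →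
              (∀ {f g} → f ≗ g → P f → P g) → Decidable P → Dec (∃ P)
∃-function? zero {P = P} respects P? = map′ (λ Pf → (λ ()) , Pf) unique (P? λ ())
  where
  unique : ∃ P → P (λ ())
  unique (_ , Pf) = respects (λ ()) Pf
∃-function? (suc m) {n} {P} respects P? =
  map′ (λ (x , g , Pxg) → x Vector.∷ g , Pxg) split
       (any? λ x → ∃-function? m (respects ∘ cons≗ x) (P? ∘ (x Vector.∷_)))
  where
  cons≗ : ∀ x {f g : Fin m → Fin n} → f ≗ g → x Vector.∷ f ≗ x Vector.∷ g
  cons≗ x f≗g 0F          = refl
  cons≗ x f≗g (Fin.suc i) = f≗g i
  split : ∃ P → ∃ λ x → ∃ λ g → P (x Vector.∷ g)
  split (f , Pf) = f 0F , f ∘ Fin.suc , respects (λ { 0F → refl ; (Fin.suc i) → refl }) Pf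

inducedSub? : ∀ {m n} (H : Graph m) (G : Graph n) → Dec (InducedSub H G)
inducedSub? {m} {n} H G = map′ (λ (f , inj , pres) → f , (λ {i} {j} → inj i j) , pres)
                               (λ (f , inj , pres) → f , (λ i j → inj) , pres)
                               (∃-function? m respects embedding?)
  where
  Embedding : (Fin m → Fin n) → Set
  Embedding f = (∀ i j → f i ≡ f j → i ≡ j) × (∀ i j → adj H i j ≡ adj G (f i) (f j))
  embedding? : Decidable Embedding
  embedding? f = (all? λ i → all? λ j → f i Fin.≟ f j →-dec i Fin.≟ j)
                 ×-dec (all? λ i → all? λ j → adj H i j Bool.≟ adj G (f i) (f j))
  respects : ∀ {f g} → f ≗ g → Embedding f → Embedding g
  respects f≗g (inj , pres) = (λ i j e → inj i j (trans (f≗g i) (trans e (sym (f≗g j)))))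
                            , (λ i j → trans (pres i j) (cong₂ (adj G) (f≗g i) (f≗g j)))

P5-adj : ∀ {i j : Fin 5} → i ≢ j → adj P5 i j ≡ near (toℕ i) (toℕ j)
P5-adj {i} {j} i≢j with toWitness {a? = table?} _ i j
  where
  table? : Dec (∀ i j → i ≡ j ⊎ adj P5 i j ≡ near (toℕ i) (toℕ j))
  table? = all? λ i → all? λ j → i Fin.≟ j ⊎-dec adj P5 i j Bool.≟ near (toℕ i) (toℕ j)
... | inj₁ i≡j = contradiction i≡j i≢j
... | inj₂ e   = e

-- Fat paths and fat cycles

≡⇒≡true⇔ : ∀ {b c} → b ≡ c → b ≡ true ⇔ c ≡ true
≡⇒≡true⇔ b≡c = mk⇔ (trans (sym b≡c)) (trans b≡c)

PathJoin⇔near : ∀ {l} {i j : Fin l} → PathJoin i j ⇔ near (toℕ i) (toℕ j) ≡ true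
PathJoin⇔near = mk⇔ (Equivalence.from near⇔ ∘ map₁ (cong toℕ))
                    (map₁ toℕ-injective ∘ Equivalence.to near⇔)

CycleAdj : ℕ → ℕ → ℕ → Set
CycleAdj l a b = a ≡ b ⊎ b ≡ suc a % suc l ⊎ a ≡ suc b % suc l

CycleJoin⇔CycleAdj : ∀ {l} {i j : Fin (suc l)} → CycleJoin i j ⇔ CycleAdj l (toℕ i) (toℕ j)
CycleJoin⇔CycleAdj = mk⇔ (map₁ (cong toℕ)) (map₁ toℕ-injective)

CycleAdj-sym⇔ : ∀ {l a b} → CycleAdj l a b ⇔ CycleAdj l b a
CycleAdj-sym⇔ {l} = mk⇔ swap swap
  where
  swap : ∀ {a b} → CycleAdj l a b → CycleAdj l b a
  swap = Sum.map sym Sum.swap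

suc%suc : ∀ {a l} → a < l → suc a % suc l ≡ suc a
suc%suc a<l = m<n⇒m%n≡m (s≤s a<l)

near⇔CycleAdj : ∀ {l a b} → a < l → b < l → near a b ≡ true ⇔ CycleAdj l a b
near⇔CycleAdj {l} {a} {b} a<l b<l = mk⇔ (to ∘ Equivalence.to near⇔) (Equivalence.from near⇔ ∘ from)
  where
  to : a ≡ b ⊎ suc a ≡ b ⊎ suc b ≡ a → CycleAdj l a b
  to = Sum.map id (Sum.map (λ e → trans (sym e) (sym (suc%suc a<l)))
                           (λ e → trans (sym e) (sym (suc%suc b<l))))
  from : CycleAdj l a b → a ≡ b ⊎ suc a ≡ b ⊎ suc b ≡ a
  from = Sum.map id (Sum.map (λ e → sym (trans e (suc%suc a<l)))
                             (λ e → sym (trans e (suc%suc b<l))))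

-- For p < l, end? l p holds iff p is 0 or l - 1: the cliques at the two ends of a fat l-path.
end? : ℕ → ℕ → Bool
end? l zero    = true
end? l (suc p) = near l (suc p)

end⇔CycleAdj : ∀ {l a} → a < l → end? l a ≡ true ⇔ CycleAdj l a l
end⇔CycleAdj {l} {zero}  _   = mk⇔ (const (inj₂ (inj₂ (sym (n%n≡0 (suc l)))))) (const refl)
end⇔CycleAdj {l} {suc a} a<l = mk⇔ (to ∘ Equivalence.to near⇔) (Equivalence.from near⇔ ∘ from)
  where
  to : l ≡ suc a ⊎ suc l ≡ suc a ⊎ suc (suc a) ≡ l → CycleAdj l (suc a) l
  to (inj₁ refl)        = contradiction a<l (<-irrefl refl)
  to (inj₂ (inj₁ refl)) = contradiction a<l (<-asym (n<1+n _))
  to (inj₂ (inj₂ e))    = inj₂ (inj₁ (trans (sym e) (sym (suc%suc a<l))))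
  from : CycleAdj l (suc a) l → l ≡ suc a ⊎ suc l ≡ suc a ⊎ suc (suc a) ≡ l
  from (inj₁ refl)     = contradiction a<l (<-irrefl refl)
  from (inj₂ (inj₁ e)) = inj₂ (inj₂ (sym (trans e (suc%suc a<l))))
  from (inj₂ (inj₂ e)) with () ← trans e (n%n≡0 (suc l))

module _ {n : ℕ} {G : Graph n} where

  P5-fromParts : ∀ {m} (part : Fin n → Fin m) → (∀ i → ∃ λ v → part v ≡ i) → 5 ≤ m →
                 (∀ {u v} → u ≢ v → toℕ (part u) < 5 → toℕ (part v) < 5 →
                    adj G u v ≡ near (toℕ (part u)) (toℕ (part v))) →
                 InducedSub P5 G
  P5-fromParts {m} part onto 5≤m adj-near = r , injective , preserves
    where
    i<m : (i : Fin 5) → toℕ i < m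
    i<m i = ≤-trans (toℕ<n i) 5≤m
    r : Fin 5 → Fin n
    r i = proj₁ (onto (fromℕ< (i<m i)))
    part-r : ∀ i → toℕ (part (r i)) ≡ toℕ i
    part-r i = trans (cong toℕ (proj₂ (onto _))) (toℕ-fromℕ< (i<m i))
    part-r<5 : ∀ i → toℕ (part (r i)) < 5
    part-r<5 i = subst (_< 5) (sym (part-r i)) (toℕ<n i)
    injective : ∀ {i j} → r i ≡ r j → i ≡ j
    injective {i} {j} e =
      toℕ-injective (trans (sym (part-r i)) (trans (cong (toℕ ∘ part) e) (part-r j)))
    preserves : ∀ i j → adj P5 i j ≡ adj G (r i) (r j)
    preserves i j = by-cases (i Fin.≟ j)
      where
      by-cases : Dec (i ≡ j) → adj P5 i j ≡ adj G (r i) (r j)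
      by-cases (yes refl) = trans (adjIrr P5 i) (sym (adjIrr G (r i)))
      by-cases (no i≢j)   = trans (P5-adj i≢j) (sym (begin
        adj G (r i) (r j)
          ≡⟨ adj-near (i≢j ∘ injective) (part-r<5 i) (part-r<5 j) ⟩
        near (toℕ (part (r i))) (toℕ (part (r j)))
          ≡⟨ cong₂ near (part-r i) (part-r j) ⟩
        near (toℕ i) (toℕ j) ∎))
        where open ≡-Reasoning

  adj-fromJoin : ∀ {J : Fin n → Fin n → Set} {u v b} →
                 (adj G u v ≡ true → u ≢ v × J u v) × (u ≢ v × J u v → adj G u v ≡ true) →
                 u ≢ v → J u v ⇔ b ≡ true → adj G u v ≡ b
  adj-fromJoin (to , from) u≢v J⇔b = Bool.⇔→≡ (mk⇔ (Equivalence.to J⇔b ∘ proj₂ ∘ to)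
                                                   (λ b≡true → from (u≢v , Equivalence.from J⇔b b≡true)))

  join-fromAdj : ∀ {J : Fin n → Fin n → Set} {u v} → (u ≢ v → adj G u v ≡ true ⇔ J u v) →
                 (adj G u v ≡ true → u ≢ v × J u v) × (u ≢ v × J u v → adj G u v ≡ true)
  join-fromAdj adj⇔ = (λ uv → adj⇒≢ G uv , Equivalence.to (adj⇔ (adj⇒≢ G uv)) uv)
                    , (λ (u≢v , join) → Equivalence.from (adj⇔ u≢v) join)

  fatPath⇒P5 : ∀ {l} → 5 ≤ l → FatPath l G → InducedSub P5 G
  fatPath⇒P5 5≤l (part , onto , joins) = P5-fromParts part onto 5≤l λ u≢v _ _ →
    adj-fromJoin {J = λ u v → PathJoin (part u) (part v)} (joins _ _) u≢v PathJoin⇔near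

  fatCycle⇒P5 : ∀ {l} → 5 ≤ l → FatCycle l G → InducedSub P5 G
  fatCycle⇒P5 5≤l (part , onto , joins) = P5-fromParts part onto (m≤n⇒m≤1+n 5≤l) λ u≢v u<5 v<5 →
    adj-fromJoin {J = λ u v → CycleJoin (part u) (part v)} (joins _ _) u≢v
      (⇔-sym (near⇔CycleAdj (<-≤-trans u<5 5≤l) (<-≤-trans v<5 5≤l)) ⇔-∘ CycleJoin⇔CycleAdj)

  partition : ∀ {m} (q : Fin n → ℕ) → (∀ u → q u < m) → (∀ {k} → k < m → ∃ λ u → q u ≡ k) →
              Σ (Fin n → Fin m) λ part → (∀ u → toℕ (part u) ≡ q u) × (∀ i → ∃ λ u → part u ≡ i)
  partition {m} q q<m onto = part , toℕ-part , part-onto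
    where
    part : Fin n → Fin m
    part u = fromℕ< (q<m u)
    toℕ-part : ∀ u → toℕ (part u) ≡ q u
    toℕ-part u = toℕ-fromℕ< (q<m u)
    part-onto : ∀ i → ∃ λ u → part u ≡ i
    part-onto i with onto (toℕ<n i)
    ... | u , qu≡i = u , toℕ-injective (trans (toℕ-part u) qu≡i)

  fatPath-fromIndex : ∀ {l} (q : Fin n → ℕ) → (∀ u → q u < l) → (∀ {k} → k < l → ∃ λ u → q u ≡ k) →
                      (∀ {u v} → u ≢ v → adj G u v ≡ near (q u) (q v)) → FatPath l G
  fatPath-fromIndex q q<l onto adj-near with partition q q<l onto
  ... | part , toℕ-part , part-onto = part , part-onto , λ u v →
    join-fromAdj {J = λ u v → PathJoin (part u) (part v)} λ u≢v →
      ⇔-sym PathJoin⇔near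
      ⇔-∘ ≡⇒≡true⇔ (trans (adj-near u≢v) (sym (cong₂ near (toℕ-part u) (toℕ-part v))))

  fatCycle-fromIndex : ∀ {l} (q : Fin n → ℕ) → (∀ u → q u < suc l) →
                       (∀ {k} → k < suc l → ∃ λ u → q u ≡ k) →
                       (∀ {u v} → u ≢ v → adj G u v ≡ true ⇔ CycleAdj l (q u) (q v)) →
                       FatCycle l G
  fatCycle-fromIndex {l} q q<l onto adj⇔ with partition q q<l onto
  ... | part , toℕ-part , part-onto = part , part-onto , λ u v →
    join-fromAdj {J = λ u v → CycleJoin (part u) (part v)} λ u≢v →
      ⇔-sym (CycleJoin⇔CycleAdj-part u v) ⇔-∘ adj⇔ u≢v
    where
    CycleJoin⇔CycleAdj-part : ∀ u v → CycleJoin (part u) (part v) ⇔ CycleAdj l (q u) (q v)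
    CycleJoin⇔CycleAdj-part u v = subst₂ (λ a b → CycleJoin (part u) (part v) ⇔ CycleAdj l a b)
                                         (toℕ-part u) (toℕ-part v) CycleJoin⇔CycleAdj

-- Induced fat paths on a vertex subset

⊂-∪⁅⁆ : ∀ {n} {V : Subset n} {x} → x ∉ V → V ⊂ V ∪ ⁅ x ⁆
⊂-∪⁅⁆ {V = V} {x} x∉V = p⊆p∪q ⁅ x ⁆ , x , x∈p∪q⁺ (inj₂ (x∈⁅x⁆ x)) , x∉V

∈-∪⁅⁆⁻ : ∀ {n} {V : Subset n} {x u} → u ∈ V ∪ ⁅ x ⁆ → u ≡ x ⊎ u ∈ V
∈-∪⁅⁆⁻ {V = V} {x} u∈ = Sum.swap (Sum.map₂ (x∈⁅y⁆⇒x≡y x) (x∈p∪q⁻ V ⁅ x ⁆ u∈))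

-- The subgraph induced by V is the fat l-path whose k-th clique is the set of vertices of V
-- with index k; index is arbitrary outside V.
record FatPathOn {n} (G : Graph n) (V : Subset n) (l : ℕ) : Set where
  field
    index      : Fin n → ℕ
    index<     : ∀ {u} → u ∈ V → index u < l
    index-onto : ∀ {k} → k < l → ∃ λ u → u ∈ V × index u ≡ k
    adj-near   : ∀ {u v} → u ∈ V → v ∈ V → u ≢ v → adj G u v ≡ near (index u) (index v)

infix 4 _∈_at_
_∈_at_ : ∀ {n} {G : Graph n} {V l} → Fin n → FatPathOn G V l → ℕ → Set
_∈_at_ {V = V} u S k = u ∈ V × FatPathOn.index S u ≡ k

HasNeighbour : ∀ {n} → Graph n → Subset n → Fin n → Set
HasNeighbour G V x = ∃ λ u → u ∈ V × adj G x u ≡ true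

hasNeighbour? : ∀ {n} (G : Graph n) V → Decidable (HasNeighbour G V)
hasNeighbour? G V x = any? λ u → u ∈? V ×-dec adj G x u Bool.≟ true

module _ {n} {G : Graph n} {V : Subset n} where

  Sees : ∀ {l} → FatPathOn G V l → Fin n → (ℕ → Bool) → Set
  Sees S x f = ∀ u → u ∈ V → adj G x u ≡ f (FatPathOn.index S u)

  sees? : ∀ {l} (S : FatPathOn G V l) x f → Dec (Sees S x f)
  sees? S x f = all? λ u → u ∈? V →-dec adj G x u Bool.≟ f (FatPathOn.index S u)

  toFatPath : ∀ {l} → (∀ u → u ∈ V) → FatPathOn G V l → FatPath l G
  toFatPath everywhere S = fatPath-fromIndex {G = G} index (λ u → index< (everywhere u))
                             (λ k<l → let (u , _ , u≡k) = index-onto k<l in u , u≡k)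
                             (adj-near (everywhere _) (everywhere _))
    where open FatPathOn S

  reverse : ∀ {m} → FatPathOn G V (suc m) → FatPathOn G V (suc m)
  reverse {m} S = record
    { index      = λ u → m ∸ index u
    ; index<     = λ {u} _ → s≤s (m∸n≤m m (index u))
    ; index-onto = onto
    ; adj-near   = λ u∈V v∈V u≢v → trans (adj-near u∈V v∈V u≢v)
                                     (sym (near-∸ m (≤-pred (index< u∈V)) (≤-pred (index< v∈V))))
    }
    where
    open FatPathOn S
    onto : ∀ {k} → k < suc m → ∃ λ u → u ∈ V × m ∸ index u ≡ k
    onto {k} (s≤s k≤m) with index-onto (s≤s (m∸n≤m m k))
    ... | u , u∈V , index≡ = u , u∈V , trans (cong (m ∸_) index≡) (m∸[m∸n]≡n k≤m)

  reverse-at : ∀ {m} {S : FatPathOn G V (suc m)} {u p} → u ∈ S at p → u ∈ reverse S at m ∸ p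
  reverse-at (u∈V , refl) = u∈V , refl

  module _ {l} (S : FatPathOn G V l) where
    open FatPathOn S

    insert : ∀ {x c l′} → x ∉ V → c < l′ → l ≤ l′ → (∀ {k} → k < l′ → k < l ⊎ k ≡ c) →
             Sees S x (near c) → FatPathOn G (V ∪ ⁅ x ⁆) l′
    insert {x} {c} {l′} x∉V c<l′ l≤l′ new-cliques sees = record
      { index      = index′
      ; index<     = index′<
      ; index-onto = onto
      ; adj-near   = adj-near′
      }
      where
      index′ : Fin n → ℕ
      index′ = Vector.updateAt index x (const c)
      index′-x : index′ x ≡ c
      index′-x = updateAt-updates x index
      index′-V : ∀ {u} → u ∈ V → index′ u ≡ index u
      index′-V {u} u∈V = updateAt-minimal u x index λ { refl → x∉V u∈V }
      index′< : ∀ {u} → u ∈ V ∪ ⁅ x ⁆ → index′ u < l′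
      index′< u∈ with ∈-∪⁅⁆⁻ u∈
      ... | inj₁ refl = subst (_< l′) (sym index′-x) c<l′
      ... | inj₂ u∈V  = subst (_< l′) (sym (index′-V u∈V)) (<-≤-trans (index< u∈V) l≤l′)
      onto : ∀ {k} → k < l′ → ∃ λ u → u ∈ V ∪ ⁅ x ⁆ × index′ u ≡ k
      onto k<l′ with new-cliques k<l′
      ... | inj₂ refl = x , x∈p∪q⁺ (inj₂ (x∈⁅x⁆ x)) , index′-x
      ... | inj₁ k<l with index-onto k<l
      ...   | u , u∈V , index≡k = u , x∈p∪q⁺ (inj₁ u∈V) , trans (index′-V u∈V) index≡k
      adj-near′ : ∀ {u v} → u ∈ V ∪ ⁅ x ⁆ → v ∈ V ∪ ⁅ x ⁆ → u ≢ v →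
                  adj G u v ≡ near (index′ u) (index′ v)
      adj-near′ u∈ v∈ u≢v with ∈-∪⁅⁆⁻ u∈ | ∈-∪⁅⁆⁻ v∈
      ... | inj₁ refl | inj₁ refl = contradiction refl u≢v
      ... | inj₁ refl | inj₂ v∈V  = trans (sees _ v∈V) (sym (cong₂ near index′-x (index′-V v∈V)))
      ... | inj₂ u∈V  | inj₁ refl = trans (adj-swap G (sees _ u∈V))
        (trans (near-sym c (index _)) (sym (cong₂ near (index′-V u∈V) index′-x)))
      ... | inj₂ u∈V  | inj₂ v∈V  =
        trans (adj-near u∈V v∈V u≢v) (sym (cong₂ near (index′-V u∈V) (index′-V v∈V)))

    extend : ∀ {x c} → x ∉ V → c ≤ l → Sees S x (near c) →
             ∃ λ l′ → l ≤ l′ × FatPathOn G (V ∪ ⁅ x ⁆) l′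
    extend x∉V c≤l sees with m≤n⇒m<n∨m≡n c≤l
    ... | inj₁ c<l  = l , ≤-refl , insert x∉V c<l ≤-refl inj₁ sees
    ... | inj₂ refl = suc l , n≤1+n l , insert x∉V ≤-refl (n≤1+n l) (m≤n⇒m<n∨m≡n ∘ ≤-pred) sees

module Cliques {n} {G : Graph n} {V : Subset n} {l} (S : FatPathOn G V l) where
  open FatPathOn S

  clique : ∀ {k} → k < l → ∃ λ u → u ∈ S at k
  clique = index-onto

  at<l : ∀ {u k} → u ∈ S at k → k < l
  at<l (u∈V , refl) = index< u∈V

  at-≢ : ∀ {u v a b} → u ∈ S at a → v ∈ S at b → a ≢ b → u ≢ v
  at-≢ (_ , u≡a) (_ , v≡b) a≢b refl = a≢b (trans (sym u≡a) v≡b)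

  ∉-≢ : ∀ {x u k} → x ∉ V → u ∈ S at k → x ≢ u
  ∉-≢ x∉V (u∈V , _) refl = x∉V u∈V

  adj-at : ∀ {u v a b} → u ∈ S at a → v ∈ S at b → a ≢ b → adj G u v ≡ near a b
  adj-at u∈@(u∈V , refl) v∈@(v∈V , refl) a≢b = adj-near u∈V v∈V (at-≢ u∈ v∈ a≢b)

  adj-succ : ∀ {u v k} → u ∈ S at k → v ∈ S at suc k → adj G u v ≡ true
  adj-succ {k = k} u∈ v∈ = trans (adj-at u∈ v∈ (<⇒≢ (n<1+n k))) (near-suc k)

  adj-pred : ∀ {u v k} → u ∈ S at suc k → v ∈ S at k → adj G u v ≡ true
  adj-pred u∈ v∈ = adj-swap G (adj-succ v∈ u∈)

  adj-same : ∀ {u v k} → u ∈ S at k → v ∈ S at k → u ≢ v → adj G u v ≡ true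
  adj-same {u} (u∈V , refl) (v∈V , v≡k) u≢v =
    trans (adj-near u∈V v∈V u≢v) (trans (cong (near (index u)) v≡k) (near-refl (index u)))

  adj-gap : ∀ {u v a b} → u ∈ S at a → v ∈ S at b → 2 + a ≤ b → adj G u v ≡ false
  adj-gap u∈ v∈ 2+a≤b = trans (adj-at u∈ v∈ (<⇒≢ (≤-trans (n≤1+n _) 2+a≤b))) (near-far 2+a≤b)

  adj-gap˘ : ∀ {u v a b} → u ∈ S at a → v ∈ S at b → 2 + b ≤ a → adj G u v ≡ false
  adj-gap˘ u∈ v∈ 2+b≤a = adj-swap G (adj-gap v∈ u∈ 2+b≤a)

  NeighbourAt : Fin n → ℕ → Set
  NeighbourAt x k = ∃ λ u → u ∈ S at k × adj G x u ≡ true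

  neighbourAt? : ∀ x → Decidable (NeighbourAt x)
  neighbourAt? x k = any? λ u → (u ∈? V ×-dec index u ≟ k) ×-dec adj G x u Bool.≟ true

  misses-below : ∀ {x m} → (∀ {i} → i < m → ¬ NeighbourAt x i) →
                 ∀ {u k} → u ∈ S at k → k < m → adj G x u ≡ false
  misses-below none u∈ k<m = Bool.¬-not λ xu → none k<m (_ , u∈ , xu)

module _ {m n} (f : Fin m → Fin n) where

  preimage? : ∀ u → Dec (∃ λ i → f i ≡ u)
  preimage? u = any? λ i → f i Fin.≟ u

  image : Subset n
  image = tabulate (does ∘ preimage?)

  ∈-image : ∀ {u} → u ∈ image → ∃ λ i → f i ≡ u
  ∈-image {u} u∈ with preimage? u | trans (sym (lookup∘tabulate (does ∘ preimage?) u)) ([]=⇒lookup u∈)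
  ... | yes preimage | _  = preimage
  ... | no _         | ()

  image-∈ : ∀ i → f i ∈ image
  image-∈ i = lookup⇒[]= (f i) image
    (trans (lookup∘tabulate (does ∘ preimage?) (f i)) (dec-true (preimage? (f i)) (i , refl)))

module _ {n} {G : Graph n} where

  P5⇒fatPathOn : InducedSub P5 G → Σ (Subset n) λ V → FatPathOn G V 5
  P5⇒fatPathOn (f , injective , embeds) = image f , record
    { index      = index
    ; index<     = index<
    ; index-onto = λ k<5 → f (fromℕ< k<5) , image-∈ f _ , trans (index-f _) (toℕ-fromℕ< k<5)
    ; adj-near   = adj-near
    }
    where
    index : Fin n → ℕ
    index u with preimage? f u
    ... | yes (i , _) = toℕ i
    ... | no _        = 0
    index-f : ∀ i → index (f i) ≡ toℕ i
    index-f i with preimage? f (f i)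
    ... | yes (j , fj≡fi) = cong toℕ (injective fj≡fi)
    ... | no none         = contradiction (i , refl) none
    index< : ∀ {u} → u ∈ image f → index u < 5
    index< u∈ with ∈-image f u∈
    ... | i , refl = subst (_< 5) (sym (index-f i)) (toℕ<n i)
    adj-near : ∀ {u v} → u ∈ image f → v ∈ image f → u ≢ v → adj G u v ≡ near (index u) (index v)
    adj-near u∈ v∈ u≢v with ∈-image f u∈ | ∈-image f v∈
    ... | i , refl | j , refl = begin
      adj G (f i) (f j)                ≡⟨ embeds i j ⟨
      adj P5 i j                       ≡⟨ P5-adj {i} {j} (λ { refl → u≢v refl }) ⟩
      near (toℕ i) (toℕ j)             ≡⟨ cong₂ near (index-f i) (index-f j) ⟨
      near (index (f i)) (index (f j)) ∎
      where open ≡-Reasoning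

-- Attaching a vertex to an induced fat path

module Leftmost {n} {G : Graph n} (K13-free : Free K13 G) (B11-free : Free B11 G)
                {V l} (S : FatPathOn G V l) (5≤l : 5 ≤ l) {x} (x∉V : x ∉ V)
                {j a} (a∈ : a ∈ S at suc j) (xa : adj G x a ≡ true)
                (leftmost : ∀ {u k} → u ∈ S at k → k ≤ j → adj G x u ≡ false) where
  open FatPathOn S
  open Cliques S

  2+j≤l : 2 + j ≤ l
  2+j≤l = at<l a∈

  private
    p : Fin n
    p = proj₁ (clique (m+n≤o⇒n≤o 1 2+j≤l))

    p∈ : p ∈ S at j
    p∈ = proj₂ (clique (m+n≤o⇒n≤o 1 2+j≤l))

    xp : adj G x p ≡ false
    xp = leftmost p∈ ≤-refl

    ap : adj G a p ≡ true
    ap = adj-pred a∈ p∈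

  sees-second : ∀ {q} → q ∈ S at 2 + j → adj G x q ≡ true
  sees-second q∈ = Bool.¬-not λ xq →
    K13-free (claw G ap (adj-swap G xa) (adj-succ a∈ q∈) (adj-swap G xp) (adj-gap p∈ q∈ ≤-refl) xq
                  (≢-sym (∉-≢ x∉V p∈)) (at-≢ p∈ q∈ (<⇒≢ (m<n+m j z<s))) (∉-≢ x∉V q∈))

  misses-beyond : ∀ {u k} → u ∈ S at k → 4 + j ≤ k → adj G x u ≡ false
  misses-beyond u∈ 4+j≤k with clique (m+n≤o⇒n≤o 2 (≤-trans (s≤s 4+j≤k) (at<l u∈)))
  ... | q , q∈ = Bool.¬-not λ xu →
    B11-free (bull G (adj-swap G xa) (sees-second q∈) (adj-succ a∈ q∈) ap xu xp
                     (adj-gap˘ q∈ p∈ ≤-refl) (adj-gap a∈ u∈ (m+n≤o⇒n≤o 1 4+j≤k))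
                     (adj-gap q∈ u∈ 4+j≤k) (adj-gap p∈ u∈ (m+n≤o⇒n≤o 2 4+j≤k)))

  sees-third : ∀ {s} → s ∈ S at 3 + j → adj G x s ≡ true
  sees-third s∈ with clique (m+n≤o⇒n≤o 1 (at<l s∈))
  ... | q , q∈ = Bool.¬-not λ xs →
    B11-free (bull G (adj-succ a∈ q∈) (adj-swap G (sees-second q∈)) (adj-swap G xa) ap
                     (adj-succ q∈ s∈) (adj-gap˘ q∈ p∈ ≤-refl) xp (adj-gap a∈ s∈ ≤-refl) xs
                     (adj-gap p∈ s∈ (n≤1+n _)))

  sees-first : ∀ {u} → u ∈ S at suc j → adj G x u ≡ true
  sees-first {u} u∈ = Bool.¬-not (by-cases refl)
    where
    au : adj G x u ≡ false → adj G a u ≡ true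
    au xu = adj-same a∈ u∈ (separated⇒≢ G xa xu)
    by-cases : ∀ {i} → i ≡ j → adj G x u ≡ false → ⊥
    by-cases {suc i} refl xu with clique (<-trans (n<1+n i) (at<l p∈))
    ... | r , r∈ =
      B11-free (bull G ap (adj-succ p∈ u∈) (au xu) (adj-swap G xa) (adj-pred p∈ r∈)
                       (adj-swap G xp) (adj-swap G xu) (adj-gap˘ a∈ r∈ ≤-refl)
                       (adj-gap˘ u∈ r∈ ≤-refl) (leftmost r∈ (n≤1+n i)))
    by-cases {zero} refl xu
      with clique {2} (m+n≤o⇒n≤o 2 5≤l) | clique {3} (m+n≤o⇒n≤o 1 5≤l) | clique {4} 5≤l
    ... | q , q∈ | s , s∈ | t , t∈ =
      B11-free (bull G (adj-succ q∈ s∈) (adj-swap G (sees-third s∈)) (adj-swap G (sees-second q∈))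
                       (adj-pred q∈ u∈) (adj-succ s∈ t∈) (adj-gap˘ s∈ u∈ ≤-refl) xu
                       (adj-gap q∈ t∈ ≤-refl) (misses-beyond t∈ ≤-refl) (adj-gap u∈ t∈ (n≤1+n _)))

  sees : Sees S x (near (2 + j))
  sees u u∈V = by-offset (offset (2 + j) (index u)) (u∈V , refl)
    where
    by-offset : ∀ {k} → Offset (2 + j) k → u ∈ S at k → adj G x u ≡ near (2 + j) k
    by-offset (far-below 2+k≤2+j@(s≤s (s≤s k≤j))) u∈ =
      trans (leftmost u∈ k≤j) (sym (near-far˘ 2+k≤2+j))
    by-offset just-below        u∈ = trans (sees-first u∈) (sym (near-suc˘ (suc j)))
    by-offset same              u∈ = trans (sees-second u∈) (sym (near-refl (2 + j)))
    by-offset just-above        u∈ = trans (sees-third u∈) (sym (near-suc (2 + j)))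
    by-offset (far-above 4+j≤k) u∈ = trans (misses-beyond u∈ 4+j≤k) (sym (near-far 4+j≤k))

module Ends {n} {G : Graph n} (K13-free : Free K13 G) (B11-free : Free B11 G)
            {V k} (S : FatPathOn G V (5 + k)) {x} (x∉V : x ∉ V)
            {a b} (a∈ : a ∈ S at 0) (b∈ : b ∈ S at 4 + k)
            (xa : adj G x a ≡ true) (xb : adj G x b ≡ true) where
  open Cliques S

  misses-middle : ∀ {u p} → u ∈ S at 2 + p → p ≤ k → adj G x u ≡ false
  misses-middle u∈ p≤k = Bool.¬-not λ xu →
    K13-free (claw G xa xu xb (adj-gap a∈ u∈ (s≤s (s≤s z≤n))) (adj-gap a∈ b∈ (s≤s (s≤s z≤n)))
                  (adj-gap u∈ b∈ (+-monoʳ-≤ 4 p≤k)) (at-≢ a∈ u∈ λ ()) (at-≢ a∈ b∈ λ ())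
                  (at-≢ u∈ b∈ (<⇒≢ (+-monoʳ-≤ 3 (m≤n⇒m≤1+n p≤k)))))

  misses-second : ∀ {u} → u ∈ S at 1 → adj G x u ≡ false
  misses-second u∈ with clique {2} (s≤s (s≤s (s≤s z≤n)))
  ... | s , s∈ = Bool.¬-not λ xu →
    B11-free (bull G (adj-swap G xu) xa (adj-pred u∈ a∈) (adj-succ u∈ s∈) xb (misses-middle s∈ z≤n)
                     (adj-gap a∈ s∈ ≤-refl) (adj-gap u∈ b∈ (s≤s (s≤s (s≤s z≤n))))
                     (adj-gap a∈ b∈ (s≤s (s≤s z≤n))) (adj-gap s∈ b∈ (s≤s (s≤s (s≤s (s≤s z≤n))))))

  sees-first : ∀ {u} → u ∈ S at 0 → adj G x u ≡ true
  sees-first u∈ with clique {1} (s≤s (s≤s z≤n)) | clique {2} (s≤s (s≤s (s≤s z≤n)))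
  ... | q , q∈ | s , s∈ = Bool.¬-not λ xu →
    B11-free (bull G (adj-succ a∈ q∈) (adj-pred q∈ u∈) (adj-same a∈ u∈ (separated⇒≢ G xa xu))
                     (adj-swap G xa) (adj-succ q∈ s∈) (adj-swap G (misses-second q∈)) (adj-swap G xu)
                     (adj-gap a∈ s∈ ≤-refl) (adj-gap u∈ s∈ ≤-refl) (misses-middle s∈ z≤n))

sees-ends : ∀ {n} {G : Graph n} → Free K13 G → Free B11 G →
            ∀ {V k} (S : FatPathOn G V (5 + k)) {x} → x ∉ V →
            ∀ {a b} → a ∈ S at 0 → b ∈ S at 4 + k → adj G x a ≡ true → adj G x b ≡ true →
            Sees S x (end? (5 + k))
sees-ends {G = G} K13-free B11-free {k = k} S {x} x∉V {a} {b} a∈ b∈ xa xb u u∈V =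
  by-position (position k (FatPathOn.index< S u∈V)) (u∈V , refl)
  where
  at-first : ∀ {v} → v ∈ S at 4 + k → v ∈ reverse S at 0
  at-first {v} v∈ = subst (v ∈ reverse S at_) (n∸n≡0 (4 + k)) (reverse-at {S = S} v∈)
  module Left  = Ends K13-free B11-free S x∉V a∈ b∈ xa xb
  module Right = Ends K13-free B11-free (reverse S) x∉V (at-first b∈) (reverse-at {S = S} a∈) xb xa
  by-position : ∀ {p} → Position k p → u ∈ S at p → adj G x u ≡ end? (5 + k) p
  by-position first        u∈ = Left.sees-first u∈
  by-position second       u∈ = Left.misses-second u∈
  by-position (middle p≤k) u∈ =
    trans (Left.misses-middle u∈ p≤k) (sym (near-far˘ (+-monoʳ-≤ 4 (m≤n⇒m≤1+n p≤k))))
  by-position penultimate  u∈ =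
    trans (Right.misses-second (subst (u ∈ reverse S at_) (m+n∸n≡m 1 k) (reverse-at {S = S} u∈)))
          (sym (near-far˘ {b = 3 + k} ≤-refl))
  by-position last         u∈ = trans (Right.sees-first (at-first u∈)) (sym (near-suc˘ (4 + k)))

module _ {n} {G : Graph n} (K13-free : Free K13 G) (B11-free : Free B11 G) {V : Subset n} where

  closing-or-extends : ∀ {l} → 5 ≤ l → (S : FatPathOn G V l) → ∀ {x} → x ∉ V → HasNeighbour G V x →
                       Sees S x (end? l) ⊎ ∃ λ l′ → l ≤ l′ × FatPathOn G (V ∪ ⁅ x ⁆) l′
  closing-or-extends {suc (suc (suc (suc (suc k))))} 5≤l@(s≤s (s≤s (s≤s (s≤s (s≤s _))))) S {x} x∉V
                     (u , u∈V , xu)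
    with least (Cliques.neighbourAt? S x) (u , (u∈V , refl) , xu)
  ... | suc j , (a , a∈ , xa) , none =
    inj₂ (extend S x∉V 2+j≤l sees)
    where open Leftmost K13-free B11-free S 5≤l x∉V a∈ xa (λ u∈ → Cliques.misses-below S none u∈ ∘ s≤s)
  ... | zero , (a , a∈ , xa) , _ with Cliques.neighbourAt? S x (4 + k)
  ...   | yes (b , b∈ , xb) = inj₁ (sees-ends K13-free B11-free S x∉V a∈ b∈ xa xb)
  -- If x misses the last clique, its leftmost neighbour in the reversed path lies beyond clique 0.
  ...   | no no-last with least (Cliques.neighbourAt? (reverse S) x) (a , reverse-at {S = S} a∈ , xa)
  ...     | zero , (b , (b∈V , b-first) , xb) , _ =
    contradiction (b , (b∈V , ≤-antisym (≤-pred (FatPathOn.index< S b∈V)) (m∸n≡0⇒m≤n b-first)) , xb)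
                  no-last
  ...     | suc j , (b , b∈ , xb) , none =
    inj₂ (extend (reverse S) x∉V 2+j≤l sees)
    where open Leftmost K13-free B11-free (reverse S) 5≤l x∉V b∈ xb
                        (λ u∈ → Cliques.misses-below (reverse S) none u∈ ∘ s≤s)

  module Saturated (conn : Connected G) {k} (S : FatPathOn G V (5 + k))
                   (maximal : ∀ {x} → x ∉ V → HasNeighbour G V x → Sees S x (end? (5 + k))) where
    open FatPathOn S
    open Cliques S

    a₀ : Fin n
    a₀ = proj₁ (clique {0} z<s)
    a₀∈ : a₀ ∈ S at 0
    a₀∈ = proj₂ (clique {0} z<s)
    a₁ : Fin n
    a₁ = proj₁ (clique {1} (s≤s z<s))
    a₁∈ : a₁ ∈ S at 1
    a₁∈ = proj₂ (clique {1} (s≤s z<s))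
    aₑ : Fin n
    aₑ = proj₁ (clique {4 + k} ≤-refl)
    aₑ∈ : aₑ ∈ S at 4 + k
    aₑ∈ = proj₂ (clique {4 + k} ≤-refl)

    module _ {y} (closing : Sees S y (end? (5 + k))) where
      closing-at : ∀ {u p} → u ∈ S at p → adj G y u ≡ end? (5 + k) p
      closing-at (u∈V , refl) = closing _ u∈V

      closing-last : adj G y aₑ ≡ true
      closing-last = trans (closing-at aₑ∈) (near-suc˘ (4 + k))

    Settled : Fin n → Set
    Settled y = y ∈ V ⊎ Sees S y (end? (5 + k))

    -- A vertex without neighbours in V, next to one that sees both end cliques, would be the
    -- third leaf of a claw.
    settled-step : ∀ {u y} → adj G u y ≡ true → Settled u → Settled y
    settled-step {u} {y} uy settled-u with y ∈? V | settled-u | hasNeighbour? G V y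
    ... | yes y∈V | _             | _           = inj₁ y∈V
    ... | no y∉V  | inj₁ u∈V      | _           = inj₂ (maximal y∉V (u , u∈V , adj-swap G uy))
    ... | no y∉V  | inj₂ _        | yes nbr     = inj₂ (maximal y∉V nbr)
    ... | no y∉V  | inj₂ u-closes | no isolated =
      ⊥-elim (K13-free (claw G (closing-at u-closes a₀∈) (closing-last u-closes) uy
                              (adj-gap a₀∈ aₑ∈ (s≤s (s≤s z≤n))) (misses a₀∈) (misses aₑ∈)
                              (at-≢ a₀∈ aₑ∈ λ ()) (≢-sym (∉-≢ y∉V a₀∈)) (≢-sym (∉-≢ y∉V aₑ∈))))
      where
      misses : ∀ {v p} → v ∈ S at p → adj G v y ≡ false
      misses (v∈V , _) = adj-swap G (Bool.¬-not λ yv → isolated (_ , v∈V , yv))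

    closing-everywhere : ∀ {y} → y ∉ V → Sees S y (end? (5 + k))
    closing-everywhere {y} y∉V with Reach-closed G Settled settled-step (conn a₀ y) (inj₁ (proj₁ a₀∈))
    ... | inj₁ y∈V    = contradiction y∈V y∉V
    ... | inj₂ closes = closes

    outside-clique : ∀ {y z} → y ∉ V → z ∉ V → y ≢ z → adj G y z ≡ true
    outside-clique {y} {z} y∉V z∉V y≢z = Bool.¬-not λ yz →
      K13-free (claw G (adj-swap G (closing-at y-closes a₀∈)) (adj-swap G (closing-at z-closes a₀∈))
                       (adj-succ a₀∈ a₁∈) yz (closing-at y-closes a₁∈) (closing-at z-closes a₁∈)
                       y≢z (∉-≢ y∉V a₁∈) (∉-≢ z∉V a₁∈))
      where
      y-closes : Sees S y (end? (5 + k))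
      y-closes = closing-everywhere y∉V
      z-closes : Sees S z (end? (5 + k))
      z-closes = closing-everywhere z∉V

    fatCycle : ∀ {x₀} → x₀ ∉ V → FatCycle (5 + k) G
    fatCycle {x₀} x₀∉V = fatCycle-fromIndex {G = G} q q< onto adj⇔
      where
      q : Fin n → ℕ
      q u with u ∈? V
      ... | yes _ = index u
      ... | no _  = 5 + k
      q< : ∀ u → q u < 6 + k
      q< u with u ∈? V
      ... | yes u∈V = m<n⇒m<1+n (index< u∈V)
      ... | no _    = ≤-refl
      q-in : ∀ {u} → u ∈ V → q u ≡ index u
      q-in {u} u∈V with u ∈? V
      ... | yes _  = refl
      ... | no u∉V = contradiction u∈V u∉V
      q-out : ∀ {u} → u ∉ V → q u ≡ 5 + k
      q-out {u} u∉V with u ∈? V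
      ... | yes u∈V = contradiction u∈V u∉V
      ... | no _    = refl
      onto : ∀ {p} → p < 6 + k → ∃ λ u → q u ≡ p
      onto p<6+k with m≤n⇒m<n∨m≡n (≤-pred p<6+k)
      ... | inj₂ refl = x₀ , q-out x₀∉V
      ... | inj₁ p<5+k with index-onto p<5+k
      ...   | u , u∈V , u≡p = u , trans (q-in u∈V) u≡p
      adj⇔ : ∀ {u v} → u ≢ v → adj G u v ≡ true ⇔ CycleAdj (5 + k) (q u) (q v)
      adj⇔ {u} {v} u≢v with u ∈? V | v ∈? V
      ... | yes u∈V | yes v∈V rewrite adj-near u∈V v∈V u≢v =
        near⇔CycleAdj (index< u∈V) (index< v∈V)
      ... | yes u∈V | no v∉V rewrite adjSym G u v | closing-everywhere v∉V u u∈V =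
        end⇔CycleAdj (index< u∈V)
      ... | no u∉V | yes v∈V rewrite closing-everywhere u∉V v v∈V =
        CycleAdj-sym⇔ {5 + k} ⇔-∘ end⇔CycleAdj (index< v∈V)
      ... | no u∉V | no v∉V =
        mk⇔ (const (inj₁ refl)) (const (outside-clique u∉V v∉V u≢v))

  saturated : Connected G → ∀ {l} → 5 ≤ l → (S : FatPathOn G V l) →
              (∀ {x} → x ∉ V → HasNeighbour G V x → Sees S x (end? l)) → InFamilyP 5 G
  saturated conn 5≤l@(s≤s (s≤s (s≤s (s≤s (s≤s _))))) S maximal with all? (_∈? V)
  ... | yes everywhere = inj₁ (_ , 5≤l , toFatPath everywhere S)
  ... | no ¬everywhere with Finₚ.¬∀⟶∃¬ n (_∈ V) (_∈? V) ¬everywhere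
  ...   | x₀ , x₀∉V = inj₂ (_ , 5≤l , Saturated.fatCycle conn S maximal x₀∉V)

grow : ∀ {n} {G : Graph n} → Free K13 G → Free B11 G → Connected G →
       ∀ {V} → Acc _⊃_ V → ∀ {l} → 5 ≤ l → FatPathOn G V l → InFamilyP 5 G
grow {G = G} K13-free B11-free conn {V} (acc larger) {l} 5≤l S
  with any? (λ x → ¬? (x ∈? V) ×-dec hasNeighbour? G V x ×-dec ¬? (sees? S x (end? l)))
... | no none =
  saturated K13-free B11-free conn 5≤l S λ {x} x∉V nbr →
    decidable-stable (sees? S x (end? l)) λ ¬closing → none (x , x∉V , nbr , ¬closing)
... | yes (x , x∉V , nbr , ¬closing) with closing-or-extends K13-free B11-free 5≤l S x∉V nbr
...   | inj₁ closing          = contradiction closing ¬closing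
...   | inj₂ (l′ , l≤l′ , S′) = grow K13-free B11-free conn (larger (⊂-∪⁅⁆ x∉V)) (≤-trans 5≤l l≤l′) S′

theorem1p2 : ∀ (n : ℕ) (G : Graph n) → Connected G → Free K13 G → Free B11 G →
    (¬ Free P5 G → InFamilyP 5 G) × (InFamilyP 5 G → ¬ Free P5 G)
theorem1p2 n G conn K13-free B11-free = has-P5⇒family , family⇒has-P5
  where
  has-P5⇒family : ¬ Free P5 G → InFamilyP 5 G
  has-P5⇒family not-free with P5⇒fatPathOn (decidable-stable (inducedSub? P5 G) not-free)
  ... | V , S = grow K13-free B11-free conn (⊃-wellFounded V) ≤-refl S
  family⇒has-P5 : InFamilyP 5 G → ¬ Free P5 G
  family⇒has-P5 (inj₁ (_ , 5≤l , path))  free = free (fatPath⇒P5 {G = G} 5≤l path)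
  family⇒has-P5 (inj₂ (_ , 5≤l , cycle)) free = free (fatCycle⇒P5 {G = G} 5≤l cycle)
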